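{- $\mathbf{T}^{Horn}$ and $\mathbf{S4}^{Horn}$ are closed under product of models: for $\mathbf{L}\in\{\mathbf{T},\mathbf{S4}\}$, every $\mathbf{L}^{Horn}$-formula $\varphi$, all models $M_1=((W_1,R_1),V_1)$, $M_2=((W_2,R_2),V_2)$ over frames in the frame class of $\mathbf{L}$, and worlds $w_1\in W_1$, $w_2\in W_2$, if $M_1,w_1\models\varphi$ and $M_2,w_2\models\varphi$ then $M_{M_1\times M_2},(w_1,w_2)\models\varphi$.
   Context: Fix a countable set $\mathcal P$ of propositional letters; Kripke models $((W,R),V)$ with $V:W\to2^{\mathcal P}$ and standard modal satisfaction. $\mathbf{T}$ is interpreted over reflexive frames, $\mathbf{S4}$ over reflexive and transitive frames. Positive literals: $\lambda ::= \top\mid p\mid\Diamond\lambda\mid\Box\lambda$. An $\mathbf{L}^{Horn}$-formula is a finite conjunction of clauses $\Box^s(\neg\lambda_1\vee\dots\vee\neg\lambda_n\vee\lambda_{n+1}\vee\dots\vee\lambda_{n+m})$ with $s,n\ge0$, $m\le1$, $\lambda_i$ positive literals. The product model $M_{M_1\times M_2}$ has worlds $W_1\times W_2$, relation $(u_1,u_2)R(v_1,v_2)$ iff $u_1R_1v_1$ and $u_2R_2v_2$, and valuation $V((u_1,u_2))=V_1(u_1)\cap V_2(u_2)$. -}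

module Defs where

open import Data.Nat using (ℕ; zero; suc)
open import Data.Unit using (⊤; tt)
open import Data.Empty using (⊥)
open import Data.Product using (_×_; _,_; Σ)
open import Data.Sum using (_⊎_)
open import Data.List using (List; []; _∷_)
open import Data.Maybe using (Maybe; just; nothing)
open import Relation.Nullary using (¬_)

Prop : Set
Prop = ℕ

data Fm : Set where
  ⊤f   : Fm
  ⊥f   : Fm
  var  : Prop → Fm
  ¬f_  : Fm → Fm
  _∧f_ : Fm → Fm → Fm
  _∨f_ : Fm → Fm → Fm
  ◇f_  : Fm → Fm
  □f_  : Fm → Fm

-- Frames and models.  A valuation V : W → 2^P is given as a
-- predicate: V w p means p ∈ V(w).
record Frame : Set₁ where
  field
    W : Set
    R : W → W → Set

record Model : Set₁ where
  field
    frame : Frame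
  open Frame frame public
  field
    V : W → Prop → Set

open Model

_,_⊨_ : (M : Model) → W M → Fm → Set
M , w ⊨ ⊤f = ⊤
M , w ⊨ ⊥f = ⊥
M , w ⊨ var p = V M w p
M , w ⊨ (¬f φ) = ¬ (M , w ⊨ φ)
M , w ⊨ (φ ∧f ψ) = (M , w ⊨ φ) × (M , w ⊨ ψ)
M , w ⊨ (φ ∨f ψ) = (M , w ⊨ φ) ⊎ (M , w ⊨ ψ)
M , w ⊨ (◇f φ) = Σ (W M) λ v → R M w v × (M , v ⊨ φ)
M , w ⊨ (□f φ) = ∀ v → R M w v → M , v ⊨ φ

Reflexive : Frame → Set
Reflexive F = ∀ w → Frame.R F w w

Transitive : Frame → Set
Transitive F = ∀ {u v w} → Frame.R F u v → Frame.R F v w → Frame.R F u w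

data Logic : Set where
  T S4 : Logic

InClass : Logic → Frame → Set
InClass T  F = Reflexive F
InClass S4 F = Reflexive F × Transitive F

data PosLit : Set where
  ⊤l  : PosLit
  varl : Prop → PosLit
  ◇l  : PosLit → PosLit
  □l  : PosLit → PosLit

litFm : PosLit → Fm
litFm ⊤l = ⊤f
litFm (varl p) = var p
litFm (◇l λ₀) = ◇f litFm λ₀
litFm (□l λ₀) = □f litFm λ₀

-- A Horn clause  □^s (¬λ₁ ∨ … ∨ ¬λₙ ∨ λₙ₊₁ ∨ … ∨ λₙ₊ₘ), n ≥ 0, m ≤ 1:
-- s, the list of negated literals λ₁…λₙ, and an optional positive literal.
record Clause : Set where
  constructor clause
  field
    depth : ℕ
    negs  : List PosLit
    pos   : Maybe PosLit

HornFormula : Set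
HornFormula = List Clause

boxes : ℕ → Fm → Fm
boxes zero φ = φ
boxes (suc s) φ = □f boxes s φ

disj : List PosLit → Maybe PosLit → Fm
disj [] nothing = ⊥f
disj [] (just λ₀) = litFm λ₀
disj (λ₀ ∷ []) nothing = ¬f litFm λ₀
disj (λ₀ ∷ l@(_ ∷ _)) m = (¬f litFm λ₀) ∨f disj l m
disj (λ₀ ∷ []) (just μ) = (¬f litFm λ₀) ∨f litFm μ

clauseFm : Clause → Fm
clauseFm (clause s ns p) = boxes s (disj ns p)

hornFm : HornFormula → Fm
hornFm [] = ⊤f
hornFm (c ∷ []) = clauseFm c
hornFm (c ∷ cs@(_ ∷ _)) = clauseFm c ∧f hornFm cs

productModel : Model → Model → Model
productModel M₁ M₂ = record
  { frame = record
      { W = W M₁ × W M₂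
      ; R = λ { (u₁ , u₂) (v₁ , v₂) → R M₁ u₁ v₁ × R M₂ u₂ v₂ } }
  ; V = λ { (u₁ , u₂) p → V M₁ u₁ p × V M₂ u₂ p } }

-- A positive literal holds at (u₁ , u₂) in a product of reflexive models exactly
-- when it holds at u₁ and at u₂; reflexivity is what lets a □-successor in one
-- coordinate be paired with the current world in the other.  Hence a failing
-- negated literal on either side fails in the product, and if none fails, the
-- positive literal holds on both sides and so in the product.  Boxes and
-- conjunctions preserve this closure property.
module Submission where

open import Defs
open import Data.List using (List; []; _∷_)
open import Data.List.Relation.Unary.Any as List using (here; there)
open import Data.Maybe using (Maybe; just; nothing)
open import Data.Maybe.Relation.Unary.Any as Maybe using (just)
open import Data.Nat using (zero; suc)
open import Data.Product using (_×_; _,_; proj₁; proj₂)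
open import Data.Sum using (_⊎_; inj₁; inj₂)
open import Data.Unit using (tt)
open import Relation.Nullary using (¬_)

InClass⇒Reflexive : ∀ L F → InClass L F → Reflexive F
InClass⇒Reflexive T  F refl = refl
InClass⇒Reflexive S4 F (refl , _) = refl

module _ (M : Model) where

  Refuted : Model.W M → PosLit → Set
  Refuted w λ₀ = ¬ (M , w ⊨ litFm λ₀)

  Verified : Model.W M → PosLit → Set
  Verified w λ₀ = M , w ⊨ litFm λ₀

  DisjHolds : Model.W M → List PosLit → Maybe PosLit → Set
  DisjHolds w ns m = List.Any (Refuted w) ns ⊎ Maybe.Any (Verified w) m

  ⊨disj⇒DisjHolds : ∀ {w} ns m → M , w ⊨ disj ns m → DisjHolds w ns m
  ⊨disj⇒DisjHolds []                nothing  ()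
  ⊨disj⇒DisjHolds []                (just _) h        = inj₂ (just h)
  ⊨disj⇒DisjHolds (_ ∷ [])          nothing  h        = inj₁ (here h)
  ⊨disj⇒DisjHolds (_ ∷ [])          (just _) (inj₁ h) = inj₁ (here h)
  ⊨disj⇒DisjHolds (_ ∷ [])          (just _) (inj₂ h) = inj₂ (just h)
  ⊨disj⇒DisjHolds (_ ∷ ns@(_ ∷ _)) m        (inj₁ h) = inj₁ (here h)
  ⊨disj⇒DisjHolds (_ ∷ ns@(_ ∷ _)) m        (inj₂ h) with ⊨disj⇒DisjHolds ns m h
  ... | inj₁ refuted  = inj₁ (there refuted)
  ... | inj₂ verified = inj₂ verified

  DisjHolds⇒⊨disj : ∀ {w} ns m → DisjHolds w ns m → M , w ⊨ disj ns m
  DisjHolds⇒⊨disj []                (just _) (inj₂ (just h))  = h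
  DisjHolds⇒⊨disj (_ ∷ [])          nothing  (inj₁ (here h))  = h
  DisjHolds⇒⊨disj (_ ∷ [])          (just _) (inj₁ (here h))  = inj₁ h
  DisjHolds⇒⊨disj (_ ∷ [])          (just _) (inj₂ (just h))  = inj₂ h
  DisjHolds⇒⊨disj (_ ∷ ns@(_ ∷ _)) m        (inj₁ (here h))  = inj₁ h
  DisjHolds⇒⊨disj (_ ∷ ns@(_ ∷ _)) m        (inj₁ (there h)) = inj₂ (DisjHolds⇒⊨disj ns m (inj₁ h))
  DisjHolds⇒⊨disj (_ ∷ ns@(_ ∷ _)) m        (inj₂ h)         = inj₂ (DisjHolds⇒⊨disj ns m (inj₂ h))

module _ (M₁ M₂ : Model) where

  private
    P : Model
    P = productModel M₁ M₂

  PreservedByProduct : Fm → Set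
  PreservedByProduct φ = ∀ u₁ u₂ → M₁ , u₁ ⊨ φ → M₂ , u₂ ⊨ φ → P , (u₁ , u₂) ⊨ φ

  product⊨lit : ∀ λ₀ → PreservedByProduct (litFm λ₀)
  product⊨lit ⊤l       u₁ u₂ _ _ = tt
  product⊨lit (varl p) u₁ u₂ h₁ h₂ = h₁ , h₂
  product⊨lit (◇l λ₀)  u₁ u₂ (v₁ , r₁ , h₁) (v₂ , r₂ , h₂) =
    (v₁ , v₂) , (r₁ , r₂) , product⊨lit λ₀ v₁ v₂ h₁ h₂
  product⊨lit (□l λ₀)  u₁ u₂ h₁ h₂ (v₁ , v₂) (r₁ , r₂) =
    product⊨lit λ₀ v₁ v₂ (h₁ v₁ r₁) (h₂ v₂ r₂)

  boxes-preserved : ∀ s {φ} → PreservedByProduct φ → PreservedByProduct (boxes s φ)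
  boxes-preserved zero    preserved = preserved
  boxes-preserved (suc s) preserved u₁ u₂ h₁ h₂ (v₁ , v₂) (r₁ , r₂) =
    boxes-preserved s preserved v₁ v₂ (h₁ v₁ r₁) (h₂ v₂ r₂)

  module _ (refl₁ : Reflexive (Model.frame M₁)) (refl₂ : Reflexive (Model.frame M₂)) where

    product⊨lit⁻¹ : ∀ λ₀ u₁ u₂ → P , (u₁ , u₂) ⊨ litFm λ₀
                  → (M₁ , u₁ ⊨ litFm λ₀) × (M₂ , u₂ ⊨ litFm λ₀)
    product⊨lit⁻¹ ⊤l       u₁ u₂ _ = tt , tt
    product⊨lit⁻¹ (varl p) u₁ u₂ h = h
    product⊨lit⁻¹ (◇l λ₀)  u₁ u₂ ((v₁ , v₂) , (r₁ , r₂) , h) =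
      let h₁ , h₂ = product⊨lit⁻¹ λ₀ v₁ v₂ h in (v₁ , r₁ , h₁) , (v₂ , r₂ , h₂)
    product⊨lit⁻¹ (□l λ₀)  u₁ u₂ h =
      (λ v₁ r₁ → proj₁ (product⊨lit⁻¹ λ₀ v₁ u₂ (h (v₁ , u₂) (r₁ , refl₂ u₂)))) ,
      (λ v₂ r₂ → proj₂ (product⊨lit⁻¹ λ₀ u₁ v₂ (h (u₁ , v₂) (refl₁ u₁ , r₂))))

    disj-preserved : ∀ ns m → PreservedByProduct (disj ns m)
    disj-preserved ns m u₁ u₂ h₁ h₂ =
      DisjHolds⇒⊨disj P ns m (combine (⊨disj⇒DisjHolds M₁ ns m h₁) (⊨disj⇒DisjHolds M₂ ns m h₂))
      where
      combine : DisjHolds M₁ u₁ ns m → DisjHolds M₂ u₂ ns m → DisjHolds P (u₁ , u₂) ns m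
      combine (inj₁ refuted₁) _ =
        inj₁ (List.map (λ {λ₀} ¬h h → ¬h (proj₁ (product⊨lit⁻¹ λ₀ u₁ u₂ h))) refuted₁)
      combine _ (inj₁ refuted₂) =
        inj₁ (List.map (λ {λ₀} ¬h h → ¬h (proj₂ (product⊨lit⁻¹ λ₀ u₁ u₂ h))) refuted₂)
      combine (inj₂ (just {λ₀} verified₁)) (inj₂ (just verified₂)) =
        inj₂ (just (product⊨lit λ₀ u₁ u₂ verified₁ verified₂))

    clause-preserved : ∀ c → PreservedByProduct (clauseFm c)
    clause-preserved (clause s ns m) = boxes-preserved s (disj-preserved ns m)

    horn-preserved : ∀ φ → PreservedByProduct (hornFm φ)
    horn-preserved []               u₁ u₂ _ _ = tt
    horn-preserved (c ∷ [])         = clause-preserved c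
    horn-preserved (c ∷ cs@(_ ∷ _)) u₁ u₂ (h₁ , hs₁) (h₂ , hs₂) =
      clause-preserved c u₁ u₂ h₁ h₂ , horn-preserved cs u₁ u₂ hs₁ hs₂

fact3p9 : (L : Logic) (φ : HornFormula) (M₁ M₂ : Model)
          → InClass L (Model.frame M₁) → InClass L (Model.frame M₂)
          → (w₁ : Model.W M₁) (w₂ : Model.W M₂)
          → M₁ , w₁ ⊨ hornFm φ → M₂ , w₂ ⊨ hornFm φ
          → productModel M₁ M₂ , (w₁ , w₂) ⊨ hornFm φ
fact3p9 L φ M₁ M₂ class₁ class₂ =
  horn-preserved M₁ M₂ (InClass⇒Reflexive L _ class₁) (InClass⇒Reflexive L _ class₂) φ
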